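{- For any cover $g$ the following are equivalent: (i) $g$ is Galois; (ii) $|{\rm Hom}(f,g)|=\deg g$ for all covers $f$ with $g\sqsubseteq f$; (iii) $|{\rm Hom}(g,f)|=\deg f$ for all covers $f$ with $f\sqsubseteq g$.
   Context: Let $\mathbf C$ be a category and $\mathbf D$ a full subcategory of $\mathbf C$. For arrows $f,g$ of $\mathbf C$ with ${\rm cod}\,f={\rm cod}\,g$, ${\rm Hom}(g,f)$ denotes the collection of all arrows $h$ of $\mathbf C$ with $g=f\circ h$. Standing assumptions: (G1) every diagram $B\to A\leftarrow C$ in $\mathbf D$ has a pullback in $\mathbf C$. (G2) (I) pushouts exist in $\mathbf D$; (II) every arrow of $\mathbf D$ is epic; (III) every monic arrow of $\mathbf D$ is an isomorphism whose inverse is an arrow of $\mathbf D$. (G3) for every object $U$ of $\mathbf C$ there is a set $\Sigma(U)$ of arrows $i$ of $\mathbf C$ with ${\rm dom}\,i$ in $\mathbf D$ and ${\rm cod}\,i=U$ such that for every arrow $u$ of $\mathbf C$ with ${\rm dom}\,u$ in $\mathbf D$ and ${\rm cod}\,u=U$ there is exactly one $i\in\Sigma(U)$ with ${\rm Hom}(u,i)\neq\emptyset$. (G4) there is a function $\deg$ from the collection of arrows of $\mathbf C$ whose codomain lies in $\mathbf D$ to the positive integers such that (I) $\deg(g\circ f)=\deg g\cdot\deg f$ whenever $f,g,g\circ f$ all lie in this collection; (II) $\deg f=\sum_{i\in\Sigma({\rm dom}\,f)}\deg(f\circ i)$ for every such $f$; (III) if $B\xrightarrow{f}A\xleftarrow{g}C$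 is a diagram in $\mathbf D$ with pullback $B\xleftarrow{p}U\xrightarrow{q}C$, then $\deg f=\deg q$ and $\deg g=\deg p$. A cover is an arrow of $\mathbf D$. For a cover $f$, ${\rm Aut}(f)$ is the set of isomorphisms in ${\rm Hom}(f,f)$; $f$ is Galois if $|{\rm Aut}(f)|=\deg f$. Write $f\sqsubseteq g$ if ${\rm cod}\,f={\rm cod}\,g$ and ${\rm Hom}(g,f)\neq\emptyset$. -}

module Defs where

open import Level using (Level; _⊔_; suc)
open import Data.Nat using (ℕ; zero; _+_; _*_; _≤_)
open import Data.Fin using (Fin)
import Data.Fin as F
open import Data.Product using (Σ; ∃; _×_; _,_; proj₁)
open import Function.Bundles using (_↔_; Inverse)
open import Relation.Binary.PropositionalEquality using (_≡_)

∑ : (n : ℕ) → (Fin n → ℕ) → ℕ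
∑ zero    a = 0
∑ (ℕ.suc n) a = a F.zero + ∑ n (λ k → a (F.suc k))

_HasCard_ : ∀ {a} → Set a → ℕ → Set a
X HasCard n = Fin n ↔ X

record Category (o ℓ : Level) : Set (Level.suc (o ⊔ ℓ)) where
  infixr 9 _∘_
  field
    Obj    : Set o
    Hom    : Obj → Obj → Set ℓ
    id     : ∀ {A} → Hom A A
    _∘_    : ∀ {A B C} → Hom B C → Hom A B → Hom A C
    assoc  : ∀ {A B C D} (h : Hom C D) (g : Hom B C) (f : Hom A B) →
             (h ∘ g) ∘ f ≡ h ∘ (g ∘ f)
    idˡ    : ∀ {A B} (f : Hom A B) → id ∘ f ≡ f
    idʳ    : ∀ {A B} (f : Hom A B) → f ∘ id ≡ f
    Hom-set : ∀ {A B} {f g : Hom A B} (p q : f ≡ g) → p ≡ q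

  -- Hom(g,f) for arrows g : X → A, f : Y → A : all h with g = f ∘ h
  HomOver : ∀ {X Y A} → Hom X A → Hom Y A → Set ℓ
  HomOver {X} {Y} g f = Σ (Hom X Y) (λ h → g ≡ f ∘ h)

  IsIso : ∀ {A B} → Hom A B → Set ℓ
  IsIso {A} {B} f = Σ (Hom B A) (λ k → (f ∘ k ≡ id) × (k ∘ f ≡ id))

  IsPullback : ∀ {A B C U} (f : Hom B A) (g : Hom C A) (p : Hom U B) (q : Hom U C) →
               Set (o ⊔ ℓ)
  IsPullback {A} {B} {C} {U} f g p q =
    (f ∘ p ≡ g ∘ q) ×
    (∀ {V} (p′ : Hom V B) (q′ : Hom V C) → f ∘ p′ ≡ g ∘ q′ →
       Σ (Hom V U) (λ u → ((p ∘ u ≡ p′) × (q ∘ u ≡ q′)) ×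
         (∀ (u′ : Hom V U) → p ∘ u′ ≡ p′ → q ∘ u′ ≡ q′ → u′ ≡ u)))

-- The setting of the paper: a category C, a full subcategory D (given by a
-- proposition-valued predicate IsD on objects), and assumptions (G1)-(G4).
record GaloisSetting (o ℓ : Level) : Set (Level.suc (o ⊔ ℓ)) where
  field
    C : Category o ℓ
  open Category C public
  field
    IsD      : Obj → Set o
    IsD-prop : ∀ {A} (d e : IsD A) → d ≡ e

    G1 : ∀ {A B C′} → IsD A → IsD B → IsD C′ → (f : Hom B A) (g : Hom C′ A) →
         Σ Obj (λ U → Σ (Hom U B) (λ p → Σ (Hom U C′) (λ q → IsPullback f g p q)))

    G2-pushout : ∀ {A B C′} → IsD A → IsD B → IsD C′ → (f : Hom A B) (g : Hom A C′) →
      Σ Obj (λ P → IsD P × Σ (Hom B P) (λ p → Σ (Hom C′ P) (λ q →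
        (p ∘ f ≡ q ∘ g) ×
        (∀ {Z} → IsD Z → (p′ : Hom B Z) (q′ : Hom C′ Z) → p′ ∘ f ≡ q′ ∘ g →
          Σ (Hom P Z) (λ u → ((u ∘ p ≡ p′) × (u ∘ q ≡ q′)) ×
            (∀ (u′ : Hom P Z) → u′ ∘ p ≡ p′ → u′ ∘ q ≡ q′ → u′ ≡ u))))))

    G2-epi : ∀ {A B} → IsD A → IsD B → (f : Hom A B) →
      ∀ {Z} → IsD Z → (h k : Hom B Z) → h ∘ f ≡ k ∘ f → h ≡ k

    -- (G2)(III) every monic arrow of D is an isomorphism (its inverse lies in D
    -- automatically, D being full)
    G2-mono : ∀ {A B} → IsD A → IsD B → (f : Hom A B) →
      (∀ {Z} → IsD Z → (h k : Hom Z A) → f ∘ h ≡ f ∘ k → h ≡ k) → IsIso f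

    -- (G3) the sets Σ(U), given as index types with the chosen arrows
    Sig     : Obj → Set (o ⊔ ℓ)
    sigDom  : ∀ {U} → Sig U → Obj
    sigDomD : ∀ {U} (s : Sig U) → IsD (sigDom s)
    sigArr  : ∀ {U} (s : Sig U) → Hom (sigDom s) U
    G3 : ∀ {U X} → IsD X → (u : Hom X U) →
      Σ (Sig U) (λ s → HomOver u (sigArr s) ×
        (∀ (s′ : Sig U) → HomOver u (sigArr s′) → s′ ≡ s))

    deg     : ∀ {X A} → IsD A → Hom X A → ℕ
    deg-pos : ∀ {X A} (dA : IsD A) (f : Hom X A) → 1 ≤ deg dA f
    G4-mult : ∀ {X Y A} (dY : IsD Y) (dA : IsD A) (g : Hom Y A) (f : Hom X Y) →
      deg dA (g ∘ f) ≡ deg dA g * deg dY f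
    G4-sum : ∀ {U A} (dA : IsD A) (f : Hom U A) →
      Σ ℕ (λ n → Σ (Fin n ↔ Sig U) (λ e →
        deg dA f ≡ ∑ n (λ k → deg dA (f ∘ sigArr (Inverse.to e k)))))
    G4-pullback : ∀ {A B C′ U} (dA : IsD A) (dB : IsD B) (dC : IsD C′)
      (f : Hom B A) (g : Hom C′ A) (p : Hom U B) (q : Hom U C′) →
      IsPullback f g p q → (deg dA f ≡ deg dC q) × (deg dA g ≡ deg dB p)

  Aut : ∀ {B A} → Hom B A → Set ℓ
  Aut {B} f = Σ (Hom B B) (λ h → (f ≡ f ∘ h) × IsIso h)

  IsGalois : ∀ {B A} → IsD A → Hom B A → Set ℓ
  IsGalois dA f = Aut f HasCard deg dA f

  _⊑_ : ∀ {X Y A} → Hom X A → Hom Y A → Set ℓ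
  f ⊑ g = HomOver g f

{-# OPTIONS --safe #-}
module Submission where

-- Lifts of a cover f through a cover g correspond to sections of the pullback projection
-- q : B ×_A Y → Y, hence to the components of B ×_A Y of degree one over Y.  As deg g = deg q
-- is the sum of the degrees of the components, there are at most deg g lifts, with equality
-- iff every component has degree one.  If g is Galois and f = g ∘ h, the lifts σ ∘ h
-- (σ ∈ Aut g) are deg g distinct ones, h being epic.  If g is Galois and g = f ∘ h, a point
-- of a component yields two points of B in one fibre of g; an automorphism of g identifies
-- them (transitivity on fibres is the previous case for f = g), and this places a section
-- through the component.  Finally, endomorphisms over a cover have degree one, hence are
-- automorphisms, so taking f = g recovers |Aut g| = deg g.

open import Defs
open import Data.Product using (_×_; Σ; _,_; proj₁; proj₂)
open import Function.Bundles using (_⇔_; _↔_; Inverse; Injection; mk↔ₛ′; mk⇔)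
open import Function.Definitions using (Injective)
open import Function.Properties.Inverse using (↔-sym; ↔-trans; ↔⇒↣)
open import Data.Nat using (ℕ; zero; suc; _+_; _*_; _≤_; z≤n; s≤s; >-nonZero)
open import Data.Nat.Properties
  using (≡-irrelevant; ≤-antisym; ≤-trans; +-mono-≤; +-monoˡ-≤; +-monoʳ-≤; +-cancelʳ-≤;
         *-identityʳ; *-cancelˡ-≡; m*n≡1⇒m≡1)
open import Data.Fin using (Fin)
import Data.Fin as Fin
import Data.Fin.Properties as Finₚ
open import Relation.Binary.PropositionalEquality

∑-ones : ∀ n (a : Fin n → ℕ) → (∀ k → a k ≡ 1) → ∑ n a ≡ n
∑-ones zero    a ones = refl
∑-ones (suc n) a ones = cong₂ _+_ (ones Fin.zero) (∑-ones n (λ k → a (Fin.suc k)) (λ k → ones (Fin.suc k)))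

n≤∑ : ∀ n (a : Fin n → ℕ) → (∀ k → 1 ≤ a k) → n ≤ ∑ n a
n≤∑ zero    a pos = z≤n
n≤∑ (suc n) a pos = +-mono-≤ (pos Fin.zero) (n≤∑ n (λ k → a (Fin.suc k)) (λ k → pos (Fin.suc k)))

∑≤n⇒ones : ∀ n (a : Fin n → ℕ) → (∀ k → 1 ≤ a k) → ∑ n a ≤ n → ∀ k → a k ≡ 1
∑≤n⇒ones (suc n) a pos ∑≤n Fin.zero = ≤-antisym a₀≤1 (pos Fin.zero)
  where
    a₀≤1 : a Fin.zero ≤ 1
    a₀≤1 = +-cancelʳ-≤ n (a Fin.zero) 1
      (≤-trans (+-monoʳ-≤ (a Fin.zero) (n≤∑ n (λ k → a (Fin.suc k)) (λ k → pos (Fin.suc k)))) ∑≤n)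
∑≤n⇒ones (suc n) a pos ∑≤n (Fin.suc k) =
  ∑≤n⇒ones n (λ k → a (Fin.suc k)) (λ k → pos (Fin.suc k)) rest≤n k
  where
    rest≤n : ∑ n (λ k → a (Fin.suc k)) ≤ n
    rest≤n with ≤-trans (+-monoˡ-≤ (∑ n (λ k → a (Fin.suc k))) (pos Fin.zero)) ∑≤n
    ... | s≤s le = le

Fin≤1-irrelevant : ∀ {n} → n ≤ 1 → (k k′ : Fin n) → k ≡ k′
Fin≤1-irrelevant {1}           _        Fin.zero Fin.zero = refl
Fin≤1-irrelevant {suc (suc _)} (s≤s ()) _        _

module _ {s} {S : Set s} {n : ℕ} (enum : Fin n ↔ S) (d : S → ℕ) where
  open Inverse enum

  ones-card : (∀ x → d x ≡ 1) → Σ S (λ x → d x ≡ 1) HasCard ∑ n (λ k → d (to k))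
  ones-card ones = subst (λ m → Fin m ↔ Σ S (λ x → d x ≡ 1)) (sym (∑-ones n _ (λ k → ones (to k))))
      (↔-trans enum (↔-sym Σ-ones↔S))
    where
      Σ-ones↔S : Σ S (λ x → d x ≡ 1) ↔ S
      Σ-ones↔S = mk↔ₛ′ proj₁ (λ x → x , ones x) (λ _ → refl)
        (λ { (x , e) → cong (x ,_) (≡-irrelevant (ones x) e) })

  injection⇒ones : (∀ x → 1 ≤ d x) → (ι : Fin (∑ n (λ k → d (to k))) → S) →
                   Injective _≡_ _≡_ ι → ∀ x → d x ≡ 1
  injection⇒ones pos ι ι-injective x = subst (λ y → d y ≡ 1) (strictlyInverseˡ x) (ones (from x))
    where
      ones : ∀ k → d (to k) ≡ 1
      ones = ∑≤n⇒ones n _ (λ k → pos (to k)) (Finₚ.injective⇒≤ (λ e →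
        ι-injective (Injection.injective (↔⇒↣ (↔-sym enum)) e)))

module CategoryFacts {o ℓ} (𝒞 : Category o ℓ) where
  open Category 𝒞
  open ≡-Reasoning

  HomOver-≡ : ∀ {X Y A} {u : Hom X A} {v : Hom Y A} {a b : HomOver u v} →
              proj₁ a ≡ proj₁ b → a ≡ b
  HomOver-≡ {a = h , e} {.h , e′} refl = cong (h ,_) (Hom-set e e′)

  HomOver-trans : ∀ {X Y Z A} {u : Hom X A} {v : Hom Y A} {w : Hom Z A} →
                  HomOver u v → HomOver v w → HomOver u w
  HomOver-trans {u = u} {v} {w} (h , u≡vh) (k , v≡wk) = k ∘ h , (begin
    u           ≡⟨ u≡vh ⟩
    v ∘ h       ≡⟨ cong (_∘ h) v≡wk ⟩
    (w ∘ k) ∘ h ≡⟨ assoc w k h ⟩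
    w ∘ (k ∘ h) ∎)

  HomOver-∘ʳ : ∀ {W X Y A} {u : Hom X A} {v : Hom Y A} → HomOver u v → (y : Hom W X) →
               HomOver (u ∘ y) v
  HomOver-∘ʳ a y = HomOver-trans (y , refl) a

  ∘-through : ∀ {W X Y Z} (x : Hom Y Z) {u : Hom W Y} {i : Hom X Y} → (m : Hom W X) →
              u ≡ i ∘ m → x ∘ u ≡ (x ∘ i) ∘ m
  ∘-through x {i = i} m u≡im = trans (cong (x ∘_) u≡im) (sym (assoc x i m))

  IsIso-irrelevant : ∀ {X Y} {h : Hom X Y} (a b : IsIso h) → a ≡ b
  IsIso-irrelevant {h = h} (k , hk , kh) (k′ , hk′ , k′h) with k≡k′
    where
      k≡k′ : k ≡ k′
      k≡k′ = begin
        k             ≡⟨ sym (idʳ k) ⟩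
        k ∘ id        ≡⟨ cong (k ∘_) (sym hk′) ⟩
        k ∘ (h ∘ k′)  ≡⟨ sym (assoc k h k′) ⟩
        (k ∘ h) ∘ k′  ≡⟨ cong (_∘ k′) kh ⟩
        id ∘ k′       ≡⟨ idˡ k′ ⟩
        k′            ∎
  ... | refl = cong₂ (λ x y → k , x , y) (Hom-set hk hk′) (Hom-set kh k′h)

  Section : ∀ {U Y} → Hom U Y → Set ℓ
  Section q = HomOver id q

  module Pullback {A B C U} {f : Hom B A} {g : Hom C A} {p : Hom U B} {q : Hom U C}
                  (pb : IsPullback f g p q) where
    commutes : f ∘ p ≡ g ∘ q
    commutes = proj₁ pb

    pair : ∀ {V} (a : Hom V B) (b : Hom V C) → f ∘ a ≡ g ∘ b → Hom V U
    pair a b e = proj₁ (proj₂ pb a b e)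

    p∘pair : ∀ {V} (a : Hom V B) (b : Hom V C) (e : f ∘ a ≡ g ∘ b) → p ∘ pair a b e ≡ a
    p∘pair a b e = proj₁ (proj₁ (proj₂ (proj₂ pb a b e)))

    q∘pair : ∀ {V} (a : Hom V B) (b : Hom V C) (e : f ∘ a ≡ g ∘ b) → q ∘ pair a b e ≡ b
    q∘pair a b e = proj₂ (proj₁ (proj₂ (proj₂ pb a b e)))

    jointly-monic : ∀ {V} (u u′ : Hom V U) → p ∘ u ≡ p ∘ u′ → q ∘ u ≡ q ∘ u′ → u ≡ u′
    jointly-monic u u′ pu≡pu′ qu≡qu′ = trans (unique u refl refl) (sym (unique u′ (sym pu≡pu′) (sym qu≡qu′)))
      where
        fpu≡gqu : f ∘ (p ∘ u) ≡ g ∘ (q ∘ u)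
        fpu≡gqu = trans (sym (assoc f p u)) (trans (cong (_∘ u) commutes) (assoc g q u))
        unique : ∀ w → p ∘ w ≡ p ∘ u → q ∘ w ≡ q ∘ u → w ≡ pair (p ∘ u) (q ∘ u) fpu≡gqu
        unique = proj₂ (proj₂ (proj₂ pb (p ∘ u) (q ∘ u) fpu≡gqu))

    lifts↔sections : HomOver g f ↔ Section q
    lifts↔sections = mk↔ₛ′ section lift
        (λ { (s , id≡qs) → HomOver-≡ (jointly-monic _ s (p∘pair (p ∘ s) id _)
                                                    (trans (q∘pair (p ∘ s) id _) id≡qs)) })
        (λ { (h , _) → HomOver-≡ (p∘pair h id _) })
      where
        section : HomOver g f → Section q
        section (h , g≡fh) = pair h id (trans (sym g≡fh) (sym (idʳ g))) , sym (q∘pair h id _)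

        lift : Section q → HomOver g f
        lift (s , id≡qs) = p ∘ s , (begin
          g            ≡⟨ sym (idʳ g) ⟩
          g ∘ id       ≡⟨ cong (g ∘_) id≡qs ⟩
          g ∘ (q ∘ s)  ≡⟨ sym (assoc g q s) ⟩
          (g ∘ q) ∘ s  ≡⟨ cong (_∘ s) (sym commutes) ⟩
          (f ∘ p) ∘ s  ≡⟨ assoc f p s ⟩
          f ∘ (p ∘ s)  ∎)

module GaloisFacts {o ℓ} (G : GaloisSetting o ℓ) where
  open GaloisSetting G
  open CategoryFacts C
  open ≡-Reasoning

  ⊑-refl : ∀ {B A} (g : Hom B A) → g ⊑ g
  ⊑-refl g = id , sym (idʳ g)

  endo-deg≡1 : ∀ {B A} (dB : IsD B) (dA : IsD A) (g : Hom B A) (h : Hom B B) →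
               g ≡ g ∘ h → deg dB h ≡ 1
  endo-deg≡1 dB dA g h g≡gh = sym (*-cancelˡ-≡ 1 (deg dB h) (deg dA g) {{>-nonZero (deg-pos dA g)}} (begin
    deg dA g * 1      ≡⟨ *-identityʳ (deg dA g) ⟩
    deg dA g          ≡⟨ cong (deg dA) g≡gh ⟩
    deg dA (g ∘ h)    ≡⟨ G4-mult dB dA g h ⟩
    deg dA g * deg dB h ∎))

  retraction-deg≡1 : ∀ {V Y} (dV : IsD V) (dY : IsD Y) (c : Hom V Y) (m : Hom Y V) →
                     c ∘ m ≡ id → deg dY c ≡ 1
  retraction-deg≡1 dV dY c m c∘m≡id = m*n≡1⇒m≡1 (deg dY c) (deg dV m) (begin
    deg dY c * deg dV m ≡⟨ sym (G4-mult dV dY c m) ⟩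
    deg dY (c ∘ m)      ≡⟨ cong (deg dY) c∘m≡id ⟩
    deg dY id           ≡⟨ endo-deg≡1 dY dY id id (sym (idʳ id)) ⟩
    1                   ∎)

  Sig-inhabited : ∀ {X Z} (dZ : IsD Z) (h : Hom X Z) → Sig X
  Sig-inhabited dZ h with G4-sum dZ h | deg-pos dZ h
  ... | zero  , _    , deg≡0 | pos with subst (1 ≤_) deg≡0 pos
  ...   | ()
  Sig-inhabited dZ h | suc _ , enum , _ | _ = Inverse.to enum Fin.zero

  deg≡1⇒Sig-irrelevant : ∀ {X Z} (dZ : IsD Z) (u : Hom X Z) → deg dZ u ≡ 1 →
                         (σ σ′ : Sig X) → σ ≡ σ′
  deg≡1⇒Sig-irrelevant dZ u deg≡1 σ σ′ with G4-sum dZ u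
  ... | n , enum , deg≡∑ = Injection.injective (↔⇒↣ (↔-sym enum))
        (Fin≤1-irrelevant (subst (n ≤_) (trans (sym deg≡∑) deg≡1) (n≤∑ n _ (λ _ → deg-pos dZ _))) _ _)

  component-unique : ∀ {V U} (dV : IsD V) (u : Hom V U) {σ σ′ : Sig U} →
                     HomOver u (sigArr σ) → HomOver u (sigArr σ′) → σ ≡ σ′
  component-unique dV u through-σ through-σ′ =
    trans (proj₂ (proj₂ (G3 dV u)) _ through-σ) (sym (proj₂ (proj₂ (G3 dV u)) _ through-σ′))

  -- A degree-one cover is monic because its kernel pair is connected and contains the diagonal.
  deg≡1⇒iso : ∀ {X Z} (dX : IsD X) (dZ : IsD Z) (h : Hom X Z) → deg dZ h ≡ 1 → IsIso h
  deg≡1⇒iso {X} dX dZ h deg≡1 with G1 dZ dX dX h h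
  ... | K , p , q , pb = G2-mono dX dZ h monic
    where
      open Pullback pb

      connected : (σ σ′ : Sig K) → σ ≡ σ′
      connected = deg≡1⇒Sig-irrelevant dX q (trans (sym (proj₁ (G4-pullback dZ dX dX h h p q pb))) deg≡1)

      diagonal : Hom X K
      diagonal = pair id id refl

      σ : Sig K
      σ = proj₁ (G3 dX diagonal)

      i : Hom (sigDom σ) K
      i = sigArr σ

      through-σ : ∀ {W} → IsD W → (u : Hom W K) → HomOver u i
      through-σ dW u = subst (λ τ → HomOver u (sigArr τ)) (connected _ σ) (proj₁ (proj₂ (G3 dW u)))

      p∘i≡q∘i : p ∘ i ≡ q ∘ i
      p∘i≡q∘i with through-σ dX diagonal
      ... | m , diagonal≡im = G2-epi dX (sigDomD σ) m dX (p ∘ i) (q ∘ i) (begin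
          (p ∘ i) ∘ m  ≡⟨ sym (∘-through p m diagonal≡im) ⟩
          p ∘ diagonal ≡⟨ p∘pair id id refl ⟩
          id           ≡⟨ sym (q∘pair id id refl) ⟩
          q ∘ diagonal ≡⟨ ∘-through q m diagonal≡im ⟩
          (q ∘ i) ∘ m  ∎)

      monic : ∀ {W} → IsD W → (a b : Hom W X) → h ∘ a ≡ h ∘ b → a ≡ b
      monic dW a b ha≡hb with through-σ dW (pair a b ha≡hb)
      ... | m , u≡im = begin
          a                   ≡⟨ sym (p∘pair a b ha≡hb) ⟩
          p ∘ pair a b ha≡hb  ≡⟨ ∘-through p m u≡im ⟩
          (p ∘ i) ∘ m         ≡⟨ cong (_∘ m) p∘i≡q∘i ⟩
          (q ∘ i) ∘ m         ≡⟨ sym (∘-through q m u≡im) ⟩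
          q ∘ pair a b ha≡hb  ≡⟨ q∘pair a b ha≡hb ⟩
          b                   ∎

  Aut-≡ : ∀ {B A} {g : Hom B A} {a b : Aut g} → proj₁ a ≡ proj₁ b → a ≡ b
  Aut-≡ {a = σ , e , i} {.σ , e′ , i′} refl = cong₂ (λ x y → σ , x , y) (Hom-set e e′) (IsIso-irrelevant i i′)

  HomOver-endo↔Aut : ∀ {B A} (dB : IsD B) (dA : IsD A) (g : Hom B A) → HomOver g g ↔ Aut g
  HomOver-endo↔Aut dB dA g = mk↔ₛ′ automorphism (λ { (h , e , _) → h , e }) (λ _ → Aut-≡ refl) (λ _ → refl)
    where
      automorphism : HomOver g g → Aut g
      automorphism (h , g≡gh) = h , g≡gh , deg≡1⇒iso dB dB h (endo-deg≡1 dB dA g h g≡gh)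

  local-lift : ∀ {B Y V} (dB : IsD B) (dY : IsD Y) (dV : IsD V) (h : Hom B Y) (v : Hom V Y) →
               Σ Obj λ W → IsD W × Σ (Hom W V) λ z → Σ (Hom W B) λ x → h ∘ x ≡ v ∘ z
  local-lift dB dY dV h v with G1 dY dB dV h v
  ... | P , a , b , ha≡vb , _ =
    sigDom j , sigDomD j , b ∘ sigArr j , a ∘ sigArr j , (begin
      h ∘ (a ∘ sigArr j) ≡⟨ sym (assoc h a (sigArr j)) ⟩
      (h ∘ a) ∘ sigArr j ≡⟨ cong (_∘ sigArr j) ha≡vb ⟩
      (v ∘ b) ∘ sigArr j ≡⟨ assoc v b (sigArr j) ⟩
      v ∘ (b ∘ sigArr j) ∎)
    where
      j : Sig P
      j = Sig-inhabited dB a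

  module Lifts {A B Y U} (dA : IsD A) (dB : IsD B) (dY : IsD Y)
               {g : Hom B A} {f : Hom Y A} {p : Hom U B} {q : Hom U Y}
               (pb : IsPullback g f p q) where
    open Pullback pb public

    DegreeOne : Sig U → Set
    DegreeOne σ = deg dY (q ∘ sigArr σ) ≡ 1

    component-iso : ∀ σ → DegreeOne σ → IsIso (q ∘ sigArr σ)
    component-iso σ = deg≡1⇒iso (sigDomD σ) dY (q ∘ sigArr σ)

    section-component-degreeOne : (s : Section q) {σ : Sig U} →
                                  HomOver (proj₁ s) (sigArr σ) → DegreeOne σ
    section-component-degreeOne (s , id≡qs) {σ} (m , s≡im) =
      retraction-deg≡1 (sigDomD σ) dY (q ∘ sigArr σ) m
        (trans (sym (∘-through q m s≡im)) (sym id≡qs))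

    meets-section⇒degreeOne : ∀ {W σ} (s : Section q) (dW : IsD W) (z : Hom W (sigDom σ)) (y : Hom W Y) →
                              proj₁ s ∘ y ≡ sigArr σ ∘ z → DegreeOne σ
    meets-section⇒degreeOne s dW z y sy≡iz with G3 dY (proj₁ s)
    ... | _ , through-s , _ =
      subst DegreeOne (component-unique dW _ (HomOver-∘ʳ through-s y) (z , sy≡iz))
        (section-component-degreeOne s through-s)

    degreeOne-≡ : {a b : Σ (Sig U) DegreeOne} → proj₁ a ≡ proj₁ b → a ≡ b
    degreeOne-≡ {σ , d} {.σ , d′} refl = cong (σ ,_) (≡-irrelevant d d′)

    sections↔degreeOne : Section q ↔ Σ (Sig U) DegreeOne
    sections↔degreeOne = mk↔ₛ′ component section
        (λ { (σ , d₁) → degreeOne-≡ (component-unique dY _ (proj₁ (proj₂ (G3 dY _))) (inverse σ d₁ , refl)) })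
        (λ s → HomOver-≡ (sym (through-inverse s)))
      where
        component : Section q → Σ (Sig U) DegreeOne
        component s = proj₁ (G3 dY (proj₁ s)) , section-component-degreeOne s (proj₁ (proj₂ (G3 dY (proj₁ s))))

        inverse : ∀ σ → DegreeOne σ → Hom Y (sigDom σ)
        inverse σ d₁ = proj₁ (component-iso σ d₁)

        section : Σ (Sig U) DegreeOne → Section q
        section (σ , d₁) = sigArr σ ∘ inverse σ d₁ ,
          sym (trans (sym (assoc q (sigArr σ) _)) (proj₁ (proj₂ (component-iso σ d₁))))

        through-inverse : ∀ s → proj₁ s ≡ proj₁ (section (component s))
        through-inverse (s , id≡qs) = begin
            s                     ≡⟨ s≡im ⟩
            sigArr σ ∘ m          ≡⟨ cong (sigArr σ ∘_) m≡r ⟩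
            sigArr σ ∘ r          ∎
          where
            σ : Sig U
            σ = proj₁ (G3 dY s)
            m : Hom Y (sigDom σ)
            m = proj₁ (proj₁ (proj₂ (G3 dY s)))
            s≡im : s ≡ sigArr σ ∘ m
            s≡im = proj₂ (proj₁ (proj₂ (G3 dY s)))
            iso : IsIso (q ∘ sigArr σ)
            iso = component-iso σ (proj₂ (component (s , id≡qs)))
            r : Hom Y (sigDom σ)
            r = proj₁ iso
            m≡r : m ≡ r
            m≡r = begin
              m                       ≡⟨ sym (idˡ m) ⟩
              id ∘ m                  ≡⟨ cong (_∘ m) (sym (proj₂ (proj₂ iso))) ⟩
              (r ∘ (q ∘ sigArr σ)) ∘ m ≡⟨ assoc r _ m ⟩
              r ∘ ((q ∘ sigArr σ) ∘ m) ≡⟨ cong (r ∘_) (sym (∘-through q m s≡im)) ⟩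
              r ∘ (q ∘ s)             ≡⟨ cong (r ∘_) (sym id≡qs) ⟩
              r ∘ id                  ≡⟨ idʳ r ⟩
              r                       ∎

    lifts↔degreeOne : HomOver f g ↔ Σ (Sig U) DegreeOne
    lifts↔degreeOne = ↔-trans lifts↔sections sections↔degreeOne

    private
      #components : ℕ
      #components = proj₁ (G4-sum dY q)

      enumeration : Fin #components ↔ Sig U
      enumeration = proj₁ (proj₂ (G4-sum dY q))

      component-degree : Fin #components → ℕ
      component-degree k = deg dY (q ∘ sigArr (Inverse.to enumeration k))

      deg≡∑ : deg dA g ≡ ∑ #components component-degree
      deg≡∑ = trans (proj₁ (G4-pullback dA dB dY g f p q pb)) (proj₂ (proj₂ (G4-sum dY q)))

    lifts-card : (∀ σ → DegreeOne σ) → HomOver f g HasCard deg dA g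
    lifts-card degreeOne = subst (λ N → Fin N ↔ HomOver f g) (sym deg≡∑)
      (↔-trans (ones-card enumeration _ degreeOne) (↔-sym lifts↔degreeOne))

    injection⇒degreeOne : (ι : Fin (deg dA g) → HomOver f g) → Injective _≡_ _≡_ ι → ∀ σ → DegreeOne σ
    injection⇒degreeOne ι ι-injective = injection⇒ones enumeration _ (λ _ → deg-pos dY _) ι′ ι′-injective
      where
        ι′ : Fin (∑ #components component-degree) → Sig U
        ι′ k = proj₁ (Inverse.to lifts↔degreeOne (ι (subst Fin (sym deg≡∑) k)))

        ι′-injective : Injective _≡_ _≡_ ι′
        ι′-injective {k} {k′} e = subst-injective (sym deg≡∑) (ι-injective
          (Injection.injective (↔⇒↣ lifts↔degreeOne) (degreeOne-≡ e)))

    factor-through-section : (∀ σ → DegreeOne σ) → ∀ {V} → IsD V → (u : Hom V U) →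
                             Σ (Section q) (λ s → u ≡ proj₁ s ∘ (q ∘ u))
    factor-through-section degreeOne dV u with G3 dV u
    ... | σ , (m , u≡im) , _ = s , (begin
        u                          ≡⟨ u≡im ⟩
        i ∘ m                      ≡⟨ cong (i ∘_) (sym (idˡ m)) ⟩
        i ∘ (id ∘ m)               ≡⟨ cong (λ x → i ∘ (x ∘ m)) (sym (proj₂ (proj₂ iso))) ⟩
        i ∘ ((r ∘ (q ∘ i)) ∘ m)    ≡⟨ cong (i ∘_) (assoc r (q ∘ i) m) ⟩
        i ∘ (r ∘ ((q ∘ i) ∘ m))    ≡⟨ cong (λ x → i ∘ (r ∘ x)) (sym (∘-through q m u≡im)) ⟩
        i ∘ (r ∘ (q ∘ u))          ≡⟨ sym (assoc i r (q ∘ u)) ⟩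
        (i ∘ r) ∘ (q ∘ u)          ∎)
      where
        i : Hom (sigDom σ) U
        i = sigArr σ
        iso : IsIso (q ∘ i)
        iso = component-iso σ (degreeOne σ)
        r : Hom Y (sigDom σ)
        r = proj₁ iso
        s : Section q
        s = i ∘ r , sym (trans (sym (assoc q i r)) (proj₁ (proj₂ iso)))

  Galois⇒degreeOne : ∀ {A B Y U} (dA : IsD A) (dB : IsD B) (dY : IsD Y)
                     {g : Hom B A} {f : Hom Y A} {p : Hom U B} {q : Hom U Y} →
                     IsGalois dA g → (pb : IsPullback g f p q) → g ⊑ f →
                     ∀ σ → Lifts.DegreeOne dA dB dY pb σ
  Galois⇒degreeOne dA dB dY {g} gal pb (h , f≡gh) =
    Lifts.injection⇒degreeOne dA dB dY pb ι ι-injective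
    where
      ι : Fin (deg dA g) → HomOver _ g
      ι k = HomOver-trans (h , f≡gh) (proj₁ (Inverse.to gal k) , proj₁ (proj₂ (Inverse.to gal k)))

      ι-injective : Injective _≡_ _≡_ ι
      ι-injective e = Injection.injective (↔⇒↣ gal)
        (Aut-≡ (G2-epi dY dB h dB _ _ (cong proj₁ e)))

  Galois-transitive : ∀ {B A V} (dB : IsD B) (dA : IsD A) {g : Hom B A} → IsGalois dA g →
                      IsD V → (x y : Hom V B) → g ∘ x ≡ g ∘ y →
                      Σ (HomOver g g) (λ τ → x ≡ proj₁ τ ∘ y)
  Galois-transitive {V = V} dB dA {g} gal dV x y gx≡gy with G1 dA dB dB g g
  ... | K , p , q , pb = Inverse.from lifts↔sections s , (begin
      x                    ≡⟨ sym (p∘pair x y gx≡gy) ⟩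
      p ∘ u                ≡⟨ cong (p ∘_) u≡s∘y ⟩
      p ∘ (proj₁ s ∘ y)    ≡⟨ sym (assoc p (proj₁ s) y) ⟩
      (p ∘ proj₁ s) ∘ y    ∎)
    where
      open Lifts dA dB dB pb

      u : Hom V K
      u = pair x y gx≡gy

      factorisation : Σ (Section q) (λ s → u ≡ proj₁ s ∘ (q ∘ u))
      factorisation = factor-through-section (Galois⇒degreeOne dA dB dB gal pb (⊑-refl g)) dV u

      s : Section q
      s = proj₁ factorisation

      u≡s∘y : u ≡ proj₁ s ∘ y
      u≡s∘y = trans (proj₂ factorisation) (cong (proj₁ s ∘_) (q∘pair x y gx≡gy))

  Galois⇒quotient-degreeOne : ∀ {A B Y U} (dA : IsD A) (dB : IsD B) (dY : IsD Y)
                              {g : Hom B A} {f : Hom Y A} {p : Hom U Y} {q : Hom U B} →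
                              IsGalois dA g → (pb : IsPullback f g p q) → f ⊑ g →
                              ∀ σ → Lifts.DegreeOne dA dY dB pb σ
  Galois⇒quotient-degreeOne {B = B} {U = U} dA dB dY {g} {f} {p} {q} gal pb (h , g≡fh) σ
    with local-lift dB dY (sigDomD σ) h (p ∘ sigArr σ)
  ... | W , dW , z , x , hx≡piz = meets-section⇒degreeOne s dW z y s∘y≡i∘z
    where
      open Lifts dA dY dB pb

      i : Hom (sigDom σ) U
      i = sigArr σ

      y : Hom W B
      y = q ∘ (i ∘ z)

      gx≡gy : g ∘ x ≡ g ∘ y
      gx≡gy = begin
        g ∘ x             ≡⟨ cong (_∘ x) g≡fh ⟩
        (f ∘ h) ∘ x       ≡⟨ assoc f h x ⟩
        f ∘ (h ∘ x)       ≡⟨ cong (f ∘_) (trans hx≡piz (assoc p i z)) ⟩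
        f ∘ (p ∘ (i ∘ z)) ≡⟨ sym (assoc f p (i ∘ z)) ⟩
        (f ∘ p) ∘ (i ∘ z) ≡⟨ cong (_∘ (i ∘ z)) commutes ⟩
        (g ∘ q) ∘ (i ∘ z) ≡⟨ assoc g q (i ∘ z) ⟩
        g ∘ y             ∎

      moved : Σ (HomOver g g) (λ τ → x ≡ proj₁ τ ∘ y)
      moved = Galois-transitive dB dA gal dW x y gx≡gy

      τ : Hom B B
      τ = proj₁ (proj₁ moved)

      s : Section q
      s = Inverse.to lifts↔sections (HomOver-trans (proj₁ moved) (h , g≡fh))

      s∘y≡i∘z : proj₁ s ∘ y ≡ i ∘ z
      s∘y≡i∘z = jointly-monic _ _
        (begin
          p ∘ (proj₁ s ∘ y) ≡⟨ sym (assoc p (proj₁ s) y) ⟩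
          (p ∘ proj₁ s) ∘ y ≡⟨ cong (_∘ y) (p∘pair (h ∘ τ) id _) ⟩
          (h ∘ τ) ∘ y       ≡⟨ assoc h τ y ⟩
          h ∘ (τ ∘ y)       ≡⟨ cong (h ∘_) (sym (proj₂ moved)) ⟩
          h ∘ x             ≡⟨ trans hx≡piz (assoc p i z) ⟩
          p ∘ (i ∘ z)       ∎)
        (begin
          q ∘ (proj₁ s ∘ y) ≡⟨ sym (assoc q (proj₁ s) y) ⟩
          (q ∘ proj₁ s) ∘ y ≡⟨ cong (_∘ y) (q∘pair (h ∘ τ) id _) ⟩
          id ∘ y            ≡⟨ idˡ y ⟩
          q ∘ (i ∘ z)       ∎)

  endo-card⇒Galois : ∀ {B A} (dB : IsD B) (dA : IsD A) (g : Hom B A) →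
                     HomOver g g HasCard deg dA g → IsGalois dA g
  endo-card⇒Galois dB dA g card = ↔-trans card (HomOver-endo↔Aut dB dA g)

  Galois⇒lifts-card : ∀ {B A Y} (dB : IsD B) (dA : IsD A) (dY : IsD Y) {g : Hom B A} (f : Hom Y A) →
                      IsGalois dA g → g ⊑ f → HomOver f g HasCard deg dA g
  Galois⇒lifts-card dB dA dY {g} f gal g⊑f with G1 dA dB dY g f
  ... | _ , _ , _ , pb = Lifts.lifts-card dA dB dY pb (Galois⇒degreeOne dA dB dY gal pb g⊑f)

  Galois⇒quotient-lifts-card : ∀ {B A Y} (dB : IsD B) (dA : IsD A) (dY : IsD Y) {g : Hom B A} (f : Hom Y A) →
                               IsGalois dA g → f ⊑ g → HomOver g f HasCard deg dA f
  Galois⇒quotient-lifts-card dB dA dY {g} f gal f⊑g with G1 dA dY dB f g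
  ... | _ , _ , _ , pb = Lifts.lifts-card dA dY dB pb (Galois⇒quotient-degreeOne dA dB dY gal pb f⊑g)

corollary3p14 : ∀ {o ℓ} (G : GaloisSetting o ℓ) → let open GaloisSetting G in
    ∀ {B A} (dB : IsD B) (dA : IsD A) (g : Hom B A) →
    (IsGalois dA g ⇔
    (∀ {Y} (dY : IsD Y) (f : Hom Y A) → g ⊑ f → HomOver f g HasCard deg dA g))
    ×
    (IsGalois dA g ⇔
    (∀ {Y} (dY : IsD Y) (f : Hom Y A) → f ⊑ g → HomOver g f HasCard deg dA f))
corollary3p14 G dB dA g =
    mk⇔ (λ gal {_} dY f → Galois⇒lifts-card dB dA dY f gal)
        (λ count → endo-card⇒Galois dB dA g (count dB g (⊑-refl g)))
  , mk⇔ (λ gal {_} dY f → Galois⇒quotient-lifts-card dB dA dY f gal)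
        (λ count → endo-card⇒Galois dB dA g (count dB g (⊑-refl g)))
  where
    open GaloisSetting G
    open GaloisFacts G
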